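{- Let $A$ be an srl-monoid satisfying the identity $z\rightarrow (x\vee y) = (z\rightarrow x) \vee (z\rightarrow y)$. Then the set of strongly convex subalgebras of $A$, ordered by inclusion, is an algebraic distributive lattice whose compact elements are exactly those of the form $\mathsf{C}[a]$ with $a\in A^{ - }$. Moreover, the compact elements form a sublattice, with joins and meets given, for all $a,b\in A^{ - }$, by $\mathsf{C}[a\wedge b] = \mathsf{C}[a] \vee \mathsf{C}[b]$ and $\mathsf{C}[a\vee b] = \mathsf{C}[a] \cap \mathsf{C}[b]$.
   Context: A commutative l-monoid is an algebra $(A,\wedge,\vee,\cdot,e)$ of type $(2,2,2,0)$ such that $(A,\wedge,\vee)$ is a lattice, $(A,\cdot,e)$ is a commutative monoid and $(a\vee b)\cdot c=(a\cdot c)\vee(b\cdot c)$ for all $a,b,c\in A$. An algebra $(A,\wedge,\vee,\cdot,\rightarrow,e)$ of type $(2,2,2,2,0)$ is an srl-monoid if $(A,\wedge,\vee,\cdot,e)$ is a commutative l-monoid and there is a subalgebra $Q$ of $(A,\wedge,\vee,\cdot,e)$ such that for all $a,b\in A$ the set $\{q\in Q: a\cdot q\leq b\}$ has a maximum and $a\rightarrow b$ equals this maximum. $A^{ - }=\{a\in A: a\le e\}$. A convex subalgebra is a subalgebra $H$ of $(A,\wedge,\vee,\cdot,\rightarrow,e)$ such that $a,b\in H$, $a\le c\le b$ imply $c\in H$; it is strongly convex if for all $a\in A$, $h\in H$ with $a\cdot h\le e\le h\rightarrow a$ one has $a\in H$. $\mathsf{C}[a]$ is the smallest strongly convex subalgebra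 containing $a$; $\vee$ on subalgebras is the join in the lattice of strongly convex subalgebras. -}

module Defs where

open import Level using (Level; suc; _⊔_)
open import Data.Nat using (ℕ)
open import Data.Fin using (Fin)
open import Data.Product using (Σ; _×_; _,_; ∃; ∃-syntax)
open import Data.Sum using (_⊎_)
open import Function using (_∘_)
open import Relation.Binary.PropositionalEquality using (_≡_)
open import Relation.Unary using (Pred; _∈_; _⊆_)
open import Algebra.Core using (Op₂)
open import Algebra.Structures using (IsCommutativeMonoid)
open import Algebra.Lattice.Structures using (IsLattice)

record CommLMonoid (ℓ : Level) : Set (suc ℓ) where
  infixr 7 _·_
  infixr 6 _∧_
  infixr 5 _∨_
  field
    Carrier : Set ℓ
    _∧_ _∨_ _·_ : Op₂ Carrier
    e : Carrier
    isLattice : IsLattice _≡_ _∨_ _∧_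
    isCommutativeMonoid : IsCommutativeMonoid _≡_ _·_ e
    ·-distrib-∨ : ∀ a b c → (a ∨ b) · c ≡ (a · c) ∨ (b · c)

  infix 4 _≤_
  _≤_ : Carrier → Carrier → Set ℓ
  a ≤ b = a ∧ b ≡ a

record SrlMonoid (ℓ : Level) : Set (suc ℓ) where
  field
    lmonoid : CommLMonoid ℓ
  open CommLMonoid lmonoid public
  infixr 4 _⇒_
  field
    _⇒_ : Op₂ Carrier
    Q : Pred Carrier ℓ
    Q-e : e ∈ Q
    Q-∧ : ∀ {a b} → a ∈ Q → b ∈ Q → (a ∧ b) ∈ Q
    Q-∨ : ∀ {a b} → a ∈ Q → b ∈ Q → (a ∨ b) ∈ Q
    Q-· : ∀ {a b} → a ∈ Q → b ∈ Q → (a · b) ∈ Q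
    ⇒-∈Q : ∀ a b → (a ⇒ b) ∈ Q
    ⇒-adj : ∀ a b → a · (a ⇒ b) ≤ b
    ⇒-max : ∀ a b q → q ∈ Q → a · q ≤ b → q ≤ (a ⇒ b)

module Order {p r : Level} {P : Set p} (_≤_ : P → P → Set r) where

  IsLub : ∀ {i} {I : Set i} → (I → P) → P → Set (p ⊔ r ⊔ i)
  IsLub F u = (∀ j → F j ≤ u) × (∀ v → (∀ j → F j ≤ v) → u ≤ v)

  IsGlb : ∀ {i} {I : Set i} → (I → P) → P → Set (p ⊔ r ⊔ i)
  IsGlb F m = (∀ j → m ≤ F j) × (∀ v → (∀ j → v ≤ F j) → v ≤ m)

  IsJoin : P → P → P → Set (p ⊔ r)
  IsJoin x y j = x ≤ j × y ≤ j × (∀ z → x ≤ z → y ≤ z → j ≤ z)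

  IsMeet : P → P → P → Set (p ⊔ r)
  IsMeet x y m = m ≤ x × m ≤ y × (∀ z → z ≤ x → z ≤ y → z ≤ m)

  IsComplete : (i : Level) → Set (p ⊔ r ⊔ suc i)
  IsComplete i = ∀ (I : Set i) (F : I → P) → (∃[ u ] IsLub F u) × (∃[ m ] IsGlb F m)

  -- x ∧ (y ∨ z) ≤ (x ∧ y) ∨ (x ∧ z)
  IsDistributive : Set (p ⊔ r)
  IsDistributive = ∀ x y z yz m xy xz j →
    IsJoin y z yz → IsMeet x yz m → IsMeet x y xy → IsMeet x z xz →
    IsJoin xy xz j → m ≤ j

  IsCompact : (i : Level) → P → Set (p ⊔ r ⊔ suc i)
  IsCompact i x = ∀ (I : Set i) (F : I → P) u → IsLub F u → x ≤ u →
    ∃[ n ] Σ (Fin n → I) λ g → ∀ v → IsLub (F ∘ g) v → x ≤ v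

  IsCompactlyGenerated : (i : Level) → Set (p ⊔ r ⊔ suc i)
  IsCompactlyGenerated i = ∀ x → ∃[ I ] Σ (I → P) λ F →
    (∀ j → IsCompact i (F j)) × IsLub {i} {I} F x

  IsAlgebraic : (i : Level) → Set (p ⊔ r ⊔ suc i)
  IsAlgebraic i = IsComplete i × IsCompactlyGenerated i

module SCSTheory {ℓ : Level} (A : SrlMonoid ℓ) where
  open SrlMonoid A

  record IsSCS (H : Pred Carrier ℓ) : Set ℓ where
    field
      e∈ : e ∈ H
      ∧∈ : ∀ {a b} → a ∈ H → b ∈ H → (a ∧ b) ∈ H
      ∨∈ : ∀ {a b} → a ∈ H → b ∈ H → (a ∨ b) ∈ H
      ·∈ : ∀ {a b} → a ∈ H → b ∈ H → (a · b) ∈ H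
      ⇒∈ : ∀ {a b} → a ∈ H → b ∈ H → (a ⇒ b) ∈ H
      convex : ∀ {a b c} → a ∈ H → b ∈ H → a ≤ c → c ≤ b → c ∈ H
      strong : ∀ {a h} → h ∈ H → a · h ≤ e → e ≤ (h ⇒ a) → a ∈ H

  SCS : Set (suc ℓ)
  SCS = Σ (Pred Carrier ℓ) IsSCS

  _⊆ₛ_ : SCS → SCS → Set ℓ
  H ⊆ₛ K = Σ.proj₁ H ⊆ Σ.proj₁ K

  data Closure (X : Pred Carrier ℓ) : Pred Carrier ℓ where
    base   : ∀ {x} → x ∈ X → Closure X x
    cl-e   : Closure X e
    cl-∧   : ∀ {a b} → Closure X a → Closure X b → Closure X (a ∧ b)
    cl-∨   : ∀ {a b} → Closure X a → Closure X b → Closure X (a ∨ b)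
    cl-·   : ∀ {a b} → Closure X a → Closure X b → Closure X (a · b)
    cl-⇒   : ∀ {a b} → Closure X a → Closure X b → Closure X (a ⇒ b)
    cl-conv : ∀ {a b c} → Closure X a → Closure X b → a ≤ c → c ≤ b → Closure X c
    cl-strong : ∀ {a h} → Closure X h → a · h ≤ e → e ≤ (h ⇒ a) → Closure X a

  Closure-isSCS : ∀ X → IsSCS (Closure X)
  Closure-isSCS X = record
    { e∈ = cl-e ; ∧∈ = cl-∧ ; ∨∈ = cl-∨ ; ·∈ = cl-· ; ⇒∈ = cl-⇒
    ; convex = cl-conv ; strong = cl-strong }

  C[_] : Carrier → SCS
  C[ a ] = Closure (λ x → x ≡ a) , Closure-isSCS _

  _∈ₛ_ : Carrier → SCS → Set ℓ
  x ∈ₛ H = Σ.proj₁ H x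

  open Order _⊆ₛ_ public

-- Every y generates the same strongly convex subalgebra as the negative element φ y, and
-- C[a] ∨ C[b] = C[a ∧ b] for negative a, b. Since a derivation in the inductive closure uses
-- only finitely many generators, the compact elements are exactly the C[a] with a ≤ e.
-- For negative a, every x ∈ C[a] is trapped by a power of c = e ⇒ a: cⁿ ≤ x and x · cⁿ ≤ e.
-- The identity, used only for z = e, makes e ⇒ (a ∨ b) the join of e ⇒ a and e ⇒ b, so an x in
-- C[a] ∩ C[b] is trapped by a power of e ⇒ (a ∨ b) ∈ C[a ∨ b]; strong convexity then puts x in
-- C[a ∨ b]. For distributivity, an element w of H ∧ (K ∨ L) lies in C[a ∧ b] for negative a ∈ K,
-- b ∈ L, and in C[c] for c = φ w ∈ H; now c ∨ a ∈ H ∧ K and c ∨ b ∈ H ∧ L force c ∨ (a ∧ b) into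
-- J = (H ∧ K) ∨ (H ∧ L), hence w ∈ C[c] ∩ C[a ∧ b] = C[c ∨ (a ∧ b)] ⊆ J.

{-# OPTIONS --safe #-}
module Submission where

open import Defs
open import Level using (Level; _⊔_)
open import Data.Nat using (ℕ; zero; suc; _+_)
open import Data.Nat.Properties using (+-suc)
open import Data.Fin using (Fin; _↑ˡ_; _↑ʳ_)
import Data.Fin as Fin
open import Data.Vec.Functional using (_++_)
open import Data.Vec.Functional.Properties using (lookup-++ˡ; lookup-++ʳ)
open import Data.Product using (Σ; _×_; ∃; ∃-syntax; ∃₂; _,_; proj₁; proj₂)
open import Data.Sum using (inj₁; inj₂)
open import Function using (_∘_; id)
open import Function.Bundles using (_⇔_; mk⇔)
open import Relation.Binary.PropositionalEquality using (_≡_; refl; sym; trans; cong; cong₂; subst; subst₂; module ≡-Reasoning)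
open import Relation.Binary.Bundles using (Poset)
open import Relation.Unary using (Pred; _∈_; _⊆_; _∪_; ⋃; ⋂)
open import Algebra.Bundles using (CommutativeSemigroup)
open import Algebra.Structures using (IsCommutativeMonoid)
open import Algebra.Lattice.Bundles using (Lattice)
import Algebra.Lattice.Properties.Lattice as LatticeProperties
import Algebra.Properties.CommutativeSemigroup as CommutativeSemigroupProperties
import Relation.Binary.Lattice.Bundles as OrderTheoretic
import Relation.Binary.Reasoning.PartialOrder as PartialOrderReasoning

module CommLMonoidProperties {ℓ : Level} (M : CommLMonoid ℓ) where
  open CommLMonoid M
  open IsCommutativeMonoid isCommutativeMonoid
    using (assoc; comm; identityˡ; identityʳ; isCommutativeSemigroup)

  private
    lattice : Lattice ℓ ℓ
    lattice = record { isLattice = isLattice }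

    -- The library orders a lattice by  a ≡ a ∧ b,  the symmetric form of _≤_; hence the syms below.
    module O = OrderTheoretic.Lattice (LatticeProperties.∨-∧-orderTheoreticLattice lattice)

    ·-commutativeSemigroup : CommutativeSemigroup ℓ ℓ
    ·-commutativeSemigroup = record { isCommutativeSemigroup = isCommutativeSemigroup }

  open CommutativeSemigroupProperties ·-commutativeSemigroup using (interchange) public

  ≤-refl : ∀ {a} → a ≤ a
  ≤-refl = sym O.refl

  ≤-reflexive : ∀ {a b} → a ≡ b → a ≤ b
  ≤-reflexive refl = ≤-refl

  ≤-trans : ∀ {a b c} → a ≤ b → b ≤ c → a ≤ c
  ≤-trans p q = sym (O.trans (sym p) (sym q))

  ≤-antisym : ∀ {a b} → a ≤ b → b ≤ a → a ≡ b
  ≤-antisym p q = O.antisym (sym p) (sym q)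

  ≤-poset : Poset ℓ ℓ ℓ
  ≤-poset = record
    { _≤_ = _≤_
    ; isPartialOrder = record
      { isPreorder = record
        { isEquivalence = O.isEquivalence ; reflexive = ≤-reflexive ; trans = ≤-trans }
      ; antisym = ≤-antisym }
    }

  module ≤-Reasoning = PartialOrderReasoning ≤-poset

  x∧y≤x : ∀ {a b} → a ∧ b ≤ a
  x∧y≤x = sym (O.x∧y≤x _ _)

  x∧y≤y : ∀ {a b} → a ∧ b ≤ b
  x∧y≤y = sym (O.x∧y≤y _ _)

  ∧-greatest : ∀ {a b c} → c ≤ a → c ≤ b → c ≤ a ∧ b
  ∧-greatest p q = sym (O.∧-greatest (sym p) (sym q))

  ∧-mono-≤ : ∀ {a b c d} → a ≤ c → b ≤ d → a ∧ b ≤ c ∧ d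
  ∧-mono-≤ p q = ∧-greatest (≤-trans x∧y≤x p) (≤-trans x∧y≤y q)

  x≤x∨y : ∀ {a b} → a ≤ a ∨ b
  x≤x∨y = sym (O.x≤x∨y _ _)

  y≤x∨y : ∀ {a b} → b ≤ a ∨ b
  y≤x∨y = sym (O.y≤x∨y _ _)

  ∨-least : ∀ {a b c} → a ≤ c → b ≤ c → a ∨ b ≤ c
  ∨-least p q = sym (O.∨-least (sym p) (sym q))

  ∨-mono-≤ : ∀ {a b c d} → a ≤ c → b ≤ d → a ∨ b ≤ c ∨ d
  ∨-mono-≤ p q = ∨-least (≤-trans p x≤x∨y) (≤-trans q y≤x∨y)

  ·-distribˡ-∨ : ∀ c a b → c · (a ∨ b) ≡ c · a ∨ c · b
  ·-distribˡ-∨ c a b = begin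
    c · (a ∨ b)     ≡⟨ comm c (a ∨ b) ⟩
    (a ∨ b) · c     ≡⟨ ·-distrib-∨ a b c ⟩
    a · c ∨ b · c   ≡⟨ cong₂ _∨_ (comm a c) (comm b c) ⟩
    c · a ∨ c · b   ∎
    where open ≡-Reasoning

  ≤⇒∨≡ : ∀ {a b} → a ≤ b → a ∨ b ≡ b
  ≤⇒∨≡ p = ≤-antisym (∨-least p ≤-refl) y≤x∨y

  ·-monoˡ-≤ : ∀ c {a b} → a ≤ b → a · c ≤ b · c
  ·-monoˡ-≤ c {a} {b} p = begin
    a · c           ≤⟨ x≤x∨y ⟩
    a · c ∨ b · c   ≡⟨ sym (·-distrib-∨ a b c) ⟩
    (a ∨ b) · c     ≡⟨ cong (_· c) (≤⇒∨≡ p) ⟩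
    b · c           ∎
    where open ≤-Reasoning

  ·-monoʳ-≤ : ∀ c {a b} → a ≤ b → c · a ≤ c · b
  ·-monoʳ-≤ c {a} {b} p = subst₂ _≤_ (comm a c) (comm b c) (·-monoˡ-≤ c p)

  ·-mono-≤ : ∀ {a b c d} → a ≤ b → c ≤ d → a · c ≤ b · d
  ·-mono-≤ {b = b} {c} p q = ≤-trans (·-monoˡ-≤ c p) (·-monoʳ-≤ b q)

  x≤e⇒x·y≤y : ∀ {a b} → a ≤ e → a · b ≤ b
  x≤e⇒x·y≤y {a} {b} p = subst (a · b ≤_) (identityˡ b) (·-monoˡ-≤ b p)

  x≤e⇒y·x≤y : ∀ {a b} → a ≤ e → b · a ≤ b
  x≤e⇒y·x≤y {a} {b} p = subst (b · a ≤_) (identityʳ b) (·-monoʳ-≤ b p)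

  x≤e⇒y≤e⇒x·y≤e : ∀ {a b} → a ≤ e → b ≤ e → a · b ≤ e
  x≤e⇒y≤e⇒x·y≤e p q = ≤-trans (x≤e⇒x·y≤y p) q

  x≤e⇒y≤e⇒x·y≤x∧y : ∀ {a b} → a ≤ e → b ≤ e → a · b ≤ a ∧ b
  x≤e⇒y≤e⇒x·y≤x∧y p q = ∧-greatest (x≤e⇒y·x≤y q) (x≤e⇒x·y≤y p)

  infixr 8 _^_
  _^_ : Carrier → ℕ → Carrier
  a ^ zero = e
  a ^ suc n = a · a ^ n

  ^-+ : ∀ a m n → a ^ (m + n) ≡ a ^ m · a ^ n
  ^-+ a zero n = sym (identityˡ _)
  ^-+ a (suc m) n = trans (cong (a ·_) (^-+ a m n)) (sym (assoc a _ _))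

  ^-≤e : ∀ {a} → a ≤ e → ∀ n → a ^ n ≤ e
  ^-≤e p zero = ≤-refl
  ^-≤e p (suc n) = x≤e⇒y≤e⇒x·y≤e p (^-≤e p n)

  ^-+-≤ˡ : ∀ {a} → a ≤ e → ∀ m n → a ^ (m + n) ≤ a ^ m
  ^-+-≤ˡ {a} p m n = subst (_≤ a ^ m) (sym (^-+ a m n)) (x≤e⇒y·x≤y (^-≤e p n))

  ^-+-≤ʳ : ∀ {a} → a ≤ e → ∀ m n → a ^ (m + n) ≤ a ^ n
  ^-+-≤ʳ {a} p m n = subst (_≤ a ^ n) (sym (^-+ a m n)) (x≤e⇒x·y≤y (^-≤e p m))

  ∨-^-≤ : ∀ {a b} → a ≤ e → b ≤ e → ∀ m n → (a ∨ b) ^ (m + n) ≤ a ^ m ∨ b ^ n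
  ∨-^-≤ p q zero n = ≤-trans (^-≤e (∨-least p q) n) x≤x∨y
  ∨-^-≤ p q (suc m) zero = ≤-trans (^-≤e (∨-least p q) (suc m + 0)) y≤x∨y
  ∨-^-≤ {a} {b} p q (suc m) (suc n) = begin
    (a ∨ b) · T                                   ≡⟨ ·-distrib-∨ a b T ⟩
    a · T ∨ b · T                                 ≤⟨ ∨-least a·T≤ b·T≤ ⟩
    a ^ suc m ∨ b ^ suc n                         ∎
    where
      open ≤-Reasoning
      T = (a ∨ b) ^ (m + suc n)
      a·T≤ : a · T ≤ a ^ suc m ∨ b ^ suc n
      a·T≤ = begin
        a · T                                     ≤⟨ ·-monoʳ-≤ a (∨-^-≤ p q m (suc n)) ⟩
        a · (a ^ m ∨ b ^ suc n)                   ≡⟨ ·-distribˡ-∨ a _ _ ⟩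
        a ^ suc m ∨ a · b ^ suc n                 ≤⟨ ∨-mono-≤ ≤-refl (x≤e⇒x·y≤y p) ⟩
        a ^ suc m ∨ b ^ suc n                     ∎
      b·T≤ : b · T ≤ a ^ suc m ∨ b ^ suc n
      b·T≤ = begin
        b · T                                     ≡⟨ cong (λ k → b · (a ∨ b) ^ k) (+-suc m n) ⟩
        b · (a ∨ b) ^ (suc m + n)                 ≤⟨ ·-monoʳ-≤ b (∨-^-≤ p q (suc m) n) ⟩
        b · (a ^ suc m ∨ b ^ n)                   ≡⟨ ·-distribˡ-∨ b _ _ ⟩
        b · a ^ suc m ∨ b ^ suc n                 ≤⟨ ∨-mono-≤ (x≤e⇒x·y≤y q) ≤-refl ⟩
        a ^ suc m ∨ b ^ suc n                     ∎

module SrlMonoidProperties {ℓ : Level} (A : SrlMonoid ℓ) where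
  open SrlMonoid A
  open IsCommutativeMonoid isCommutativeMonoid using (comm; identityˡ; identityʳ)
  open CommLMonoidProperties lmonoid public

  e≤⇒-intro : ∀ {h x} → h ≤ x → e ≤ (h ⇒ x)
  e≤⇒-intro {h} {x} p = ⇒-max h x e Q-e (subst (_≤ x) (sym (identityʳ h)) p)

  e≤⇒-elim : ∀ {h x} → e ≤ (h ⇒ x) → h ≤ x
  e≤⇒-elim {h} {x} p = subst (_≤ x) (identityʳ h) (≤-trans (·-monoʳ-≤ h p) (⇒-adj h x))

  [y⇒e]≤e : ∀ {y} → e ≤ y → (y ⇒ e) ≤ e
  [y⇒e]≤e {y} p = subst (_≤ e) (identityˡ (y ⇒ e)) (≤-trans (·-monoˡ-≤ (y ⇒ e) p) (⇒-adj y e))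

  [e⇒x]≤x : ∀ x → (e ⇒ x) ≤ x
  [e⇒x]≤x x = subst (_≤ x) (identityˡ _) (⇒-adj e x)

  [x⇒y]·x≤y : ∀ x y → (x ⇒ y) · x ≤ y
  [x⇒y]·x≤y x y = subst (_≤ y) (comm x (x ⇒ y)) (⇒-adj x y)

  ^-∈Q : ∀ {c} → c ∈ Q → ∀ n → c ^ n ∈ Q
  ^-∈Q c∈Q zero = Q-e
  ^-∈Q c∈Q (suc n) = Q-· c∈Q (^-∈Q c∈Q n)

module SCSProperties {ℓ : Level} (A : SrlMonoid ℓ) where
  open SrlMonoid A
  open SCSTheory A
  open SrlMonoidProperties A
  open IsCommutativeMonoid isCommutativeMonoid using (assoc; identityˡ; identityʳ)

  Closure-least : ∀ {X H : Pred Carrier ℓ} → IsSCS H → X ⊆ H → Closure X ⊆ H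
  Closure-least S X⊆H (base x∈X) = X⊆H x∈X
  Closure-least S X⊆H cl-e = IsSCS.e∈ S
  Closure-least S X⊆H (cl-∧ p q) = IsSCS.∧∈ S (Closure-least S X⊆H p) (Closure-least S X⊆H q)
  Closure-least S X⊆H (cl-∨ p q) = IsSCS.∨∈ S (Closure-least S X⊆H p) (Closure-least S X⊆H q)
  Closure-least S X⊆H (cl-· p q) = IsSCS.·∈ S (Closure-least S X⊆H p) (Closure-least S X⊆H q)
  Closure-least S X⊆H (cl-⇒ p q) = IsSCS.⇒∈ S (Closure-least S X⊆H p) (Closure-least S X⊆H q)
  Closure-least S X⊆H (cl-conv p q a≤c c≤b) =
    IsSCS.convex S (Closure-least S X⊆H p) (Closure-least S X⊆H q) a≤c c≤b
  Closure-least S X⊆H (cl-strong p ah≤e e≤h⇒a) = IsSCS.strong S (Closure-least S X⊆H p) ah≤e e≤h⇒a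

  Closure-mono : ∀ {X Y : Pred Carrier ℓ} → X ⊆ Y → Closure X ⊆ Closure Y
  Closure-mono X⊆Y = Closure-least (Closure-isSCS _) (λ x∈X → base (X⊆Y x∈X))

  a∈C[a] : ∀ a → a ∈ₛ C[ a ]
  a∈C[a] a = base refl

  C-least : ∀ {H : Pred Carrier ℓ} {a} → IsSCS H → a ∈ H → proj₁ C[ a ] ⊆ H
  C-least S a∈H = Closure-least S (λ { refl → a∈H })

  ∈-upto-e : ∀ {H : Pred Carrier ℓ} → IsSCS H → ∀ {a c} → a ∈ H → a ≤ c → c ≤ e → c ∈ H
  ∈-upto-e S a∈H a≤c c≤e = IsSCS.convex S a∈H (IsSCS.e∈ S) a≤c c≤e

  C-antitone : ∀ {a b} → a ≤ b → b ≤ e → C[ b ] ⊆ₛ C[ a ]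
  C-antitone a≤b b≤e = C-least (Closure-isSCS _) (∈-upto-e (Closure-isSCS _) (a∈C[a] _) a≤b b≤e)

  ^-∈ : ∀ {H : Pred Carrier ℓ} → IsSCS H → ∀ {c} → c ∈ H → ∀ n → c ^ n ∈ H
  ^-∈ S c∈H zero = IsSCS.e∈ S
  ^-∈ S c∈H (suc n) = IsSCS.·∈ S c∈H (^-∈ S c∈H n)

  φ : Carrier → Carrier
  φ y = (y ∧ e) ∧ ((y ∨ e) ⇒ e)

  φ-≤e : ∀ y → φ y ≤ e
  φ-≤e y = ≤-trans x∧y≤x x∧y≤y

  module _ {H : Pred Carrier ℓ} (S : IsSCS H) where
    open IsSCS S

    φ-∈ : ∀ {y} → y ∈ H → φ y ∈ H
    φ-∈ y∈H = ∧∈ (∧∈ y∈H e∈) (⇒∈ (∨∈ y∈H e∈) e∈)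

    φ-∈⁻¹ : ∀ {y} → φ y ∈ H → y ∈ H
    φ-∈⁻¹ {y} φy∈H = convex y∧e∈H y∨e∈H x∧y≤x x≤x∨y
      where
        y∧e∈H : y ∧ e ∈ H
        y∧e∈H = ∈-upto-e S φy∈H x∧y≤x x∧y≤y
        h≤e : ((y ∨ e) ⇒ e) ≤ e
        h≤e = [y⇒e]≤e y≤x∨y
        h∈H : ((y ∨ e) ⇒ e) ∈ H
        h∈H = ∈-upto-e S φy∈H x∧y≤y h≤e
        y∨e∈H : y ∨ e ∈ H
        y∨e∈H = strong h∈H (⇒-adj (y ∨ e) e) (e≤⇒-intro (≤-trans h≤e y≤x∨y))

  y∈C[φy] : ∀ y → y ∈ₛ C[ φ y ]
  y∈C[φy] y = φ-∈⁻¹ (Closure-isSCS _) (a∈C[a] (φ y))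

  infix 4 _Traps_
  _Traps_ : Carrier → Carrier → Set ℓ
  h Traps x = h ≤ x × x · h ≤ e

  Traps-antitone : ∀ {h h′ x} → h Traps x → h′ ≤ h → h′ Traps x
  Traps-antitone {x = x} (h≤x , xh≤e) h′≤h = ≤-trans h′≤h h≤x , ≤-trans (·-monoʳ-≤ x h′≤h) xh≤e

  ∨-Traps : ∀ {h h′ x} → h Traps x → h′ Traps x → h ∨ h′ Traps x
  ∨-Traps {h} {h′} {x} (h≤x , xh≤e) (h′≤x , xh′≤e) =
    ∨-least h≤x h′≤x , subst (_≤ e) (sym (·-distribˡ-∨ x h h′)) (∨-least xh≤e xh′≤e)

  module _ {p : Carrier} where
    Traps-∧ : ∀ {x y} → p Traps x → p Traps y → p Traps x ∧ y
    Traps-∧ {x} {y} (p≤x , xp≤e) (p≤y , _) = ∧-greatest p≤x p≤y , ≤-trans (·-monoˡ-≤ p x∧y≤x) xp≤e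

    Traps-∨ : ∀ {x y} → p Traps x → p Traps y → p Traps x ∨ y
    Traps-∨ {x} {y} (p≤x , xp≤e) (_ , yp≤e) =
      ≤-trans p≤x x≤x∨y , subst (_≤ e) (sym (·-distrib-∨ x y p)) (∨-least xp≤e yp≤e)

    Traps-· : ∀ {x y} → p Traps x → p Traps y → p · p Traps x · y
    Traps-· {x} {y} (p≤x , xp≤e) (p≤y , yp≤e) =
      ·-mono-≤ p≤x p≤y ,
      subst (_≤ e) (sym (interchange x y p p)) (x≤e⇒y≤e⇒x·y≤e xp≤e yp≤e)

    Traps-⇒ : ∀ {x y} → p ∈ Q → p Traps x → p Traps y → p · p Traps (x ⇒ y)
    Traps-⇒ {x} {y} p∈Q (p≤x , xp≤e) (p≤y , yp≤e) = ⇒-max x y (p · p) (Q-· p∈Q p∈Q) x·pp≤y , [x⇒y]·pp≤e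
      where
        open ≤-Reasoning
        x·pp≤y : x · (p · p) ≤ y
        x·pp≤y = begin
          x · (p · p)        ≡⟨ sym (assoc x p p) ⟩
          (x · p) · p        ≤⟨ ·-monoˡ-≤ p xp≤e ⟩
          e · p              ≡⟨ identityˡ p ⟩
          p                  ≤⟨ p≤y ⟩
          y                  ∎
        [x⇒y]·pp≤e : (x ⇒ y) · (p · p) ≤ e
        [x⇒y]·pp≤e = begin
          (x ⇒ y) · (p · p)  ≡⟨ sym (assoc (x ⇒ y) p p) ⟩
          ((x ⇒ y) · p) · p  ≤⟨ ·-monoˡ-≤ p (·-monoʳ-≤ (x ⇒ y) p≤x) ⟩
          ((x ⇒ y) · x) · p  ≤⟨ ·-monoˡ-≤ p ([x⇒y]·x≤y x y) ⟩
          y · p              ≤⟨ yp≤e ⟩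
          e                  ∎

    Traps-convex : ∀ {a b c} → p Traps a → p Traps b → a ≤ c → c ≤ b → p Traps c
    Traps-convex (p≤a , _) (_ , bp≤e) a≤c c≤b = ≤-trans p≤a a≤c , ≤-trans (·-monoˡ-≤ p c≤b) bp≤e

    Traps-strong : ∀ {a h} → p Traps h → a · h ≤ e → e ≤ (h ⇒ a) → p Traps a
    Traps-strong {a} (p≤h , _) ah≤e e≤h⇒a = ≤-trans p≤h (e≤⇒-elim e≤h⇒a) , ≤-trans (·-monoʳ-≤ a p≤h) ah≤e

  PowerTrapped : Carrier → Pred Carrier ℓ
  PowerTrapped c x = ∃[ n ] c ^ n Traps x

  module _ {c : Carrier} (c∈Q : c ∈ Q) (c≤e : c ≤ e) where
    private
      withCommonPower : ∀ {x y z} → (∀ n → c ^ n Traps x → c ^ n Traps y → PowerTrapped c z) →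
                        PowerTrapped c x → PowerTrapped c y → PowerTrapped c z
      withCommonPower k (m , tx) (n , ty) =
        k (m + n) (Traps-antitone tx (^-+-≤ˡ c≤e m n)) (Traps-antitone ty (^-+-≤ʳ c≤e m n))

      squared : ∀ {x} n → c ^ n · c ^ n Traps x → PowerTrapped c x
      squared n t = n + n , subst (_Traps _) (sym (^-+ c n n)) t

    PowerTrapped-isSCS : IsSCS (PowerTrapped c)
    PowerTrapped-isSCS = record
      { e∈ = 0 , ≤-refl , x≤e⇒y≤e⇒x·y≤e ≤-refl ≤-refl
      ; ∧∈ = withCommonPower λ n tx ty → n , Traps-∧ tx ty
      ; ∨∈ = withCommonPower λ n tx ty → n , Traps-∨ tx ty
      ; ·∈ = withCommonPower λ n tx ty → squared n (Traps-· tx ty)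
      ; ⇒∈ = withCommonPower λ n tx ty → squared n (Traps-⇒ (^-∈Q c∈Q n) tx ty)
      ; convex = λ ta tb a≤d d≤b → withCommonPower (λ n ta tb → n , Traps-convex ta tb a≤d d≤b) ta tb
      ; strong = λ { (n , th) ah≤e e≤h⇒a → n , Traps-strong th ah≤e e≤h⇒a }
      }

  C⊆PowerTrapped : ∀ {a} → a ≤ e → proj₁ C[ a ] ⊆ PowerTrapped (e ⇒ a)
  C⊆PowerTrapped {a} a≤e = C-least (PowerTrapped-isSCS (⇒-∈Q e a) e⇒a≤e) (1 , e⇒a-traps-a)
    where
      e⇒a≤e : (e ⇒ a) ≤ e
      e⇒a≤e = ≤-trans ([e⇒x]≤x a) a≤e
      e⇒a-traps-a : (e ⇒ a) ^ 1 Traps a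
      e⇒a-traps-a = subst (_Traps a) (sym (identityʳ (e ⇒ a)))
        ([e⇒x]≤x a , x≤e⇒y≤e⇒x·y≤e a≤e e⇒a≤e)

  ⋃ₛ : ∀ {i} {I : Set i} → (I → SCS) → Pred Carrier (i ⊔ ℓ)
  ⋃ₛ {I = I} F = ⋃ I (proj₁ ∘ F)

  ⋁ₛ : ∀ {I : Set ℓ} → (I → SCS) → SCS
  ⋁ₛ F = Closure (⋃ₛ F) , Closure-isSCS _

  ⋁ₛ-isLub : ∀ {I : Set ℓ} (F : I → SCS) → IsLub F (⋁ₛ F)
  ⋁ₛ-isLub F = (λ i x∈Fi → base (i , x∈Fi)) ,
               λ H H-ub → Closure-least (proj₂ H) (λ { (i , x∈Fi) → H-ub i x∈Fi })

  ⋂ₛ : ∀ {I : Set ℓ} → (I → SCS) → SCS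
  ⋂ₛ {I} F = ⋂ I (proj₁ ∘ F) , record
    { e∈ = λ i → IsSCS.e∈ (S i)
    ; ∧∈ = λ p q i → IsSCS.∧∈ (S i) (p i) (q i)
    ; ∨∈ = λ p q i → IsSCS.∨∈ (S i) (p i) (q i)
    ; ·∈ = λ p q i → IsSCS.·∈ (S i) (p i) (q i)
    ; ⇒∈ = λ p q i → IsSCS.⇒∈ (S i) (p i) (q i)
    ; convex = λ p q a≤c c≤b i → IsSCS.convex (S i) (p i) (q i) a≤c c≤b
    ; strong = λ p ah≤e e≤h⇒a i → IsSCS.strong (S i) (p i) ah≤e e≤h⇒a
    }
    where
      S : ∀ i → IsSCS (proj₁ (F i))
      S = proj₂ ∘ F

  ⋂ₛ-isGlb : ∀ {I : Set ℓ} (F : I → SCS) → IsGlb F (⋂ₛ F)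
  ⋂ₛ-isGlb F = (λ i x∈⋂ → x∈⋂ i) , λ H H-lb x∈H i → H-lb i x∈H

  isComplete : IsComplete ℓ
  isComplete I F = (⋁ₛ F , ⋁ₛ-isLub F) , (⋂ₛ F , ⋂ₛ-isGlb F)

  FinitelyDerivable : ∀ {I : Set ℓ} → (I → SCS) → Pred Carrier ℓ
  FinitelyDerivable {I} F x = ∃[ n ] Σ (Fin n → I) λ g → x ∈ Closure (⋃ₛ (F ∘ g))

  module _ {I : Set ℓ} (F : I → SCS) where
    ⋃ₛ-++ˡ : ∀ {m n} (g : Fin m → I) (h : Fin n → I) → ⋃ₛ (F ∘ g) ⊆ ⋃ₛ (F ∘ (g ++ h))
    ⋃ₛ-++ˡ {n = n} g h {x} (i , x∈Fgi) =
      i ↑ˡ n , subst (λ j → x ∈ₛ F j) (sym (lookup-++ˡ g h i)) x∈Fgi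

    ⋃ₛ-++ʳ : ∀ {m n} (g : Fin m → I) (h : Fin n → I) → ⋃ₛ (F ∘ h) ⊆ ⋃ₛ (F ∘ (g ++ h))
    ⋃ₛ-++ʳ {m = m} g h {x} (i , x∈Fhi) =
      m ↑ʳ i , subst (λ j → x ∈ₛ F j) (sym (lookup-++ʳ g h i)) x∈Fhi

    FinitelyDerivable-merge : ∀ {a b c} → (∀ {X} → Closure X a → Closure X b → Closure X c) →
                              FinitelyDerivable F a → FinitelyDerivable F b → FinitelyDerivable F c
    FinitelyDerivable-merge k (m , g , a∈) (n , h , b∈) =
      m + n , g ++ h , k (Closure-mono (⋃ₛ-++ˡ g h) a∈) (Closure-mono (⋃ₛ-++ʳ g h) b∈)

    Closure-⋃ₛ-finitary : Closure (⋃ₛ F) ⊆ FinitelyDerivable F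
    Closure-⋃ₛ-finitary (base (i , x∈Fi)) = 1 , (λ _ → i) , base (Fin.zero , x∈Fi)
    Closure-⋃ₛ-finitary cl-e = 0 , (λ ()) , cl-e
    Closure-⋃ₛ-finitary (cl-∧ p q) =
      FinitelyDerivable-merge cl-∧ (Closure-⋃ₛ-finitary p) (Closure-⋃ₛ-finitary q)
    Closure-⋃ₛ-finitary (cl-∨ p q) =
      FinitelyDerivable-merge cl-∨ (Closure-⋃ₛ-finitary p) (Closure-⋃ₛ-finitary q)
    Closure-⋃ₛ-finitary (cl-· p q) =
      FinitelyDerivable-merge cl-· (Closure-⋃ₛ-finitary p) (Closure-⋃ₛ-finitary q)
    Closure-⋃ₛ-finitary (cl-⇒ p q) =
      FinitelyDerivable-merge cl-⇒ (Closure-⋃ₛ-finitary p) (Closure-⋃ₛ-finitary q)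
    Closure-⋃ₛ-finitary (cl-conv p q a≤c c≤b) =
      FinitelyDerivable-merge (λ p′ q′ → cl-conv p′ q′ a≤c c≤b)
        (Closure-⋃ₛ-finitary p) (Closure-⋃ₛ-finitary q)
    Closure-⋃ₛ-finitary (cl-strong p ah≤e e≤h⇒a) with Closure-⋃ₛ-finitary p
    ... | n , g , h∈ = n , g , cl-strong h∈ ah≤e e≤h⇒a

  C-compact : ∀ a → IsCompact ℓ C[ a ]
  C-compact a I F U (_ , U-least) Ca⊆U with Closure-⋃ₛ-finitary F a∈⋁F
    where
      a∈⋁F : a ∈ Closure (⋃ₛ F)
      a∈⋁F = U-least (⋁ₛ F) (proj₁ (⋁ₛ-isLub F)) (Ca⊆U (a∈C[a] a))
  ... | n , g , a∈⋁Fg =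
    n , g , λ V (V-ub , _) →
      C-least (proj₂ V) (Closure-least (proj₂ V) (λ { (i , x∈Fgi) → V-ub i x∈Fgi }) a∈⋁Fg)

  IsCompact-resp : ∀ H K → H ⊆ₛ K → K ⊆ₛ H → IsCompact ℓ K → IsCompact ℓ H
  IsCompact-resp H K H⊆K K⊆H K-compact I F U U-lub H⊆U
    with K-compact I F U U-lub (λ x∈K → H⊆U (K⊆H x∈K))
  ... | n , g , K⊆subjoin = n , g , λ V V-lub x∈H → K⊆subjoin V V-lub (H⊆K x∈H)

  ⋀φ : ∀ n → (Fin n → Carrier) → Carrier
  ⋀φ zero xs = e
  ⋀φ (suc n) xs = φ (xs Fin.zero) ∧ ⋀φ n (xs ∘ Fin.suc)

  ⋀φ-≤e : ∀ n xs → ⋀φ n xs ≤ e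
  ⋀φ-≤e zero xs = ≤-refl
  ⋀φ-≤e (suc n) xs = ≤-trans x∧y≤x (φ-≤e (xs Fin.zero))

  module _ {H : Pred Carrier ℓ} (S : IsSCS H) where
    ⋀φ-∈ : ∀ n xs → (∀ i → xs i ∈ H) → ⋀φ n xs ∈ H
    ⋀φ-∈ zero xs xs∈H = IsSCS.e∈ S
    ⋀φ-∈ (suc n) xs xs∈H = IsSCS.∧∈ S (φ-∈ S (xs∈H Fin.zero)) (⋀φ-∈ n (xs ∘ Fin.suc) (xs∈H ∘ Fin.suc))

    ⋀φ-∈⁻¹ : ∀ n xs → ⋀φ n xs ∈ H → ∀ i → xs i ∈ H
    ⋀φ-∈⁻¹ (suc n) xs ⋀∈H Fin.zero = φ-∈⁻¹ S (∈-upto-e S ⋀∈H x∧y≤x (φ-≤e (xs Fin.zero)))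
    ⋀φ-∈⁻¹ (suc n) xs ⋀∈H (Fin.suc i) = ⋀φ-∈⁻¹ n (xs ∘ Fin.suc) (∈-upto-e S ⋀∈H x∧y≤y (⋀φ-≤e n _)) i

  C-⋀φ-isLub : ∀ n xs → IsLub (λ i → C[ xs i ]) C[ ⋀φ n xs ]
  C-⋀φ-isLub n xs =
    (λ i → C-least (Closure-isSCS _) (⋀φ-∈⁻¹ (Closure-isSCS _) n xs (a∈C[a] _) i)) ,
    λ H H-ub → C-least (proj₂ H) (⋀φ-∈ (proj₂ H) n xs (λ i → H-ub i (a∈C[a] (xs i))))

  Members : SCS → Set ℓ
  Members H = Σ Carrier (_∈ₛ H)

  C-members-isLub : ∀ H → IsLub (λ (x : Members H) → C[ proj₁ x ]) H
  C-members-isLub H = (λ (x , x∈H) → C-least (proj₂ H) x∈H) , λ K K-ub x∈H → K-ub (_ , x∈H) (a∈C[a] _)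

  IsPrincipal : SCS → Set ℓ
  IsPrincipal H = ∃[ a ] (a ≤ e × H ⊆ₛ C[ a ] × C[ a ] ⊆ₛ H)

  compact⇒principal : ∀ H → IsCompact ℓ H → IsPrincipal H
  compact⇒principal H H-compact with H-compact (Members H) (λ x → C[ proj₁ x ]) H (C-members-isLub H) id
  ... | n , g , H⊆subjoin =
    ⋀φ n xs , ⋀φ-≤e n xs , H⊆subjoin C[ ⋀φ n xs ] (C-⋀φ-isLub n xs) ,
    C-least (proj₂ H) (⋀φ-∈ (proj₂ H) n xs (proj₂ ∘ g))
    where
      xs : Fin n → Carrier
      xs = proj₁ ∘ g

  principal⇒compact : ∀ H → IsPrincipal H → IsCompact ℓ H
  principal⇒compact H (a , _ , H⊆Ca , Ca⊆H) = IsCompact-resp H C[ a ] H⊆Ca Ca⊆H (C-compact a)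

  isCompactlyGenerated : IsCompactlyGenerated ℓ
  isCompactlyGenerated H = Members H , (λ x → C[ proj₁ x ]) , (C-compact ∘ proj₁) , C-members-isLub H

  IsJoin-mono : ∀ {H K H′ K′} J J′ → H ⊆ₛ H′ → K ⊆ₛ K′ → IsJoin H K J → IsJoin H′ K′ J′ → J ⊆ₛ J′
  IsJoin-mono J J′ H⊆H′ K⊆K′ (_ , _ , J-least) (H′⊆J′ , K′⊆J′ , _) =
    J-least J′ (λ x∈H → H′⊆J′ (H⊆H′ x∈H)) (λ x∈K → K′⊆J′ (K⊆K′ x∈K))

  IsMeet-mono : ∀ {H K H′ K′} M M′ → H ⊆ₛ H′ → K ⊆ₛ K′ → IsMeet H K M → IsMeet H′ K′ M′ → M ⊆ₛ M′
  IsMeet-mono M M′ H⊆H′ K⊆K′ (M⊆H , M⊆K , _) (_ , _ , M′-greatest) =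
    M′-greatest M (λ x∈M → H⊆H′ (M⊆H x∈M)) (λ x∈M → K⊆K′ (M⊆K x∈M))

  C-∧-isJoin : ∀ {a b} → a ≤ e → b ≤ e → IsJoin C[ a ] C[ b ] C[ a ∧ b ]
  C-∧-isJoin a≤e b≤e =
    C-antitone x∧y≤x a≤e , C-antitone x∧y≤y b≤e ,
    λ J Ca⊆J Cb⊆J → C-least (proj₂ J) (IsSCS.∧∈ (proj₂ J) (Ca⊆J (a∈C[a] _)) (Cb⊆J (a∈C[a] _)))

  IsJoin-compact : ∀ H K J → IsCompact ℓ H → IsCompact ℓ K → IsJoin H K J → IsCompact ℓ J
  IsJoin-compact H K J H-compact K-compact J-join
    with compact⇒principal H H-compact | compact⇒principal K K-compact
  ... | a , a≤e , H⊆Ca , Ca⊆H | b , b≤e , K⊆Cb , Cb⊆K =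
    IsCompact-resp J C[ a ∧ b ] (IsJoin-mono {H} {K} {C[ a ]} {C[ b ]} J C[ a ∧ b ] H⊆Ca K⊆Cb J-join (C-∧-isJoin a≤e b≤e))
      (IsJoin-mono {C[ a ]} {C[ b ]} {H} {K} C[ a ∧ b ] J Ca⊆H Cb⊆K (C-∧-isJoin a≤e b≤e) J-join)
      (C-compact (a ∧ b))

  ∨-∈-IsMeet : ∀ {H K M a b} → IsMeet H K M → a ∈ₛ H → b ∈ₛ K → a ≤ e → b ≤ e → (a ∨ b) ∈ₛ M
  ∨-∈-IsMeet {H} {K} {M} {a} {b} (_ , _ , M-greatest) a∈H b∈K a≤e b≤e =
    M-greatest C[ a ∨ b ]
      (C-least (proj₂ H) (∈-upto-e (proj₂ H) a∈H x≤x∨y a∨b≤e))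
      (C-least (proj₂ K) (∈-upto-e (proj₂ K) b∈K y≤x∨y a∨b≤e))
      (a∈C[a] (a ∨ b))
    where
      a∨b≤e : a ∨ b ≤ e
      a∨b≤e = ∨-least a≤e b≤e

  -- q = (c ∨ a) ∧ (c ∨ b) ∈ H is negative and q · q ≤ c ∨ (a ∧ b), so strong convexity applies.
  ∨-∈-∧-closed : ∀ {H : Pred Carrier ℓ} → IsSCS H → ∀ {a b c} → a ≤ e → b ≤ e → c ≤ e →
                 c ∨ a ∈ H → c ∨ b ∈ H → c ∨ (a ∧ b) ∈ H
  ∨-∈-∧-closed {H} S {a} {b} {c} a≤e b≤e c≤e c∨a∈H c∨b∈H =
    IsSCS.strong S q·q∈H (x≤e⇒y≤e⇒x·y≤e t≤e q·q≤e) (e≤⇒-intro q·q≤t)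
    where
      open ≤-Reasoning
      q = (c ∨ a) ∧ (c ∨ b)
      t = c ∨ (a ∧ b)
      t≤e : t ≤ e
      t≤e = ∨-least c≤e (≤-trans x∧y≤x a≤e)
      q∈H : q ∈ H
      q∈H = IsSCS.∧∈ S c∨a∈H c∨b∈H
      q·q∈H : q · q ∈ H
      q·q∈H = IsSCS.·∈ S q∈H q∈H
      q≤e : q ≤ e
      q≤e = ≤-trans x∧y≤x (∨-least c≤e a≤e)
      q·q≤e : q · q ≤ e
      q·q≤e = x≤e⇒y≤e⇒x·y≤e q≤e q≤e
      q·q≤t : q · q ≤ t
      q·q≤t = begin
        q · q                              ≤⟨ ·-mono-≤ x∧y≤x x∧y≤y ⟩
        (c ∨ a) · (c ∨ b)                  ≡⟨ ·-distrib-∨ c a (c ∨ b) ⟩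
        c · (c ∨ b) ∨ a · (c ∨ b)          ≡⟨ cong (c · (c ∨ b) ∨_) (·-distribˡ-∨ a c b) ⟩
        c · (c ∨ b) ∨ (a · c ∨ a · b)      ≤⟨ ∨-mono-≤ (x≤e⇒y·x≤y (∨-least c≤e b≤e))
                                                        (∨-mono-≤ (x≤e⇒x·y≤y a≤e) (x≤e⇒y≤e⇒x·y≤x∧y a≤e b≤e)) ⟩
        c ∨ (c ∨ (a ∧ b))                  ≤⟨ ∨-least x≤x∨y ≤-refl ⟩
        t                                  ∎

  _∨ₛ_ : SCS → SCS → SCS
  H ∨ₛ K = Closure (proj₁ H ∪ proj₁ K) , Closure-isSCS _

  InJoinOfNegatives : SCS → SCS → Pred Carrier ℓ
  InJoinOfNegatives H K u = ∃₂ λ a b → (a ∈ₛ H × a ≤ e) × (b ∈ₛ K × b ≤ e) × u ∈ₛ C[ a ∧ b ]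

  module _ (H K : SCS) where
    private
      SH = proj₂ H
      SK = proj₂ K

      merge : ∀ {u₁ u₂ u} → (∀ {X} → Closure X u₁ → Closure X u₂ → Closure X u) →
              InJoinOfNegatives H K u₁ → InJoinOfNegatives H K u₂ → InJoinOfNegatives H K u
      merge k (a₁ , b₁ , (a₁∈H , a₁≤e) , (b₁∈K , b₁≤e) , u₁∈)
              (a₂ , b₂ , (a₂∈H , a₂≤e) , (b₂∈K , b₂≤e) , u₂∈) =
        a₁ ∧ a₂ , b₁ ∧ b₂ ,
        (IsSCS.∧∈ SH a₁∈H a₂∈H , ≤-trans x∧y≤x a₁≤e) ,
        (IsSCS.∧∈ SK b₁∈K b₂∈K , ≤-trans x∧y≤x b₁≤e) ,
        k (C-antitone (∧-mono-≤ x∧y≤x x∧y≤x) (≤-trans x∧y≤x a₁≤e) u₁∈)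
          (C-antitone (∧-mono-≤ x∧y≤y x∧y≤y) (≤-trans x∧y≤x a₂≤e) u₂∈)

    ∨ₛ⊆InJoinOfNegatives : proj₁ (H ∨ₛ K) ⊆ InJoinOfNegatives H K
    ∨ₛ⊆InJoinOfNegatives {u} (base (inj₁ u∈H)) =
      φ u , e , (φ-∈ SH u∈H , φ-≤e u) , (IsSCS.e∈ SK , ≤-refl) , C-antitone x∧y≤x (φ-≤e u) (y∈C[φy] u)
    ∨ₛ⊆InJoinOfNegatives {u} (base (inj₂ u∈K)) =
      e , φ u , (IsSCS.e∈ SH , ≤-refl) , (φ-∈ SK u∈K , φ-≤e u) , C-antitone x∧y≤y (φ-≤e u) (y∈C[φy] u)
    ∨ₛ⊆InJoinOfNegatives cl-e = e , e , (IsSCS.e∈ SH , ≤-refl) , (IsSCS.e∈ SK , ≤-refl) , cl-e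
    ∨ₛ⊆InJoinOfNegatives (cl-∧ p q) = merge cl-∧ (∨ₛ⊆InJoinOfNegatives p) (∨ₛ⊆InJoinOfNegatives q)
    ∨ₛ⊆InJoinOfNegatives (cl-∨ p q) = merge cl-∨ (∨ₛ⊆InJoinOfNegatives p) (∨ₛ⊆InJoinOfNegatives q)
    ∨ₛ⊆InJoinOfNegatives (cl-· p q) = merge cl-· (∨ₛ⊆InJoinOfNegatives p) (∨ₛ⊆InJoinOfNegatives q)
    ∨ₛ⊆InJoinOfNegatives (cl-⇒ p q) = merge cl-⇒ (∨ₛ⊆InJoinOfNegatives p) (∨ₛ⊆InJoinOfNegatives q)
    ∨ₛ⊆InJoinOfNegatives (cl-conv p q a≤c c≤b) =
      merge (λ p′ q′ → cl-conv p′ q′ a≤c c≤b) (∨ₛ⊆InJoinOfNegatives p) (∨ₛ⊆InJoinOfNegatives q)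
    ∨ₛ⊆InJoinOfNegatives (cl-strong p ah≤e e≤h⇒a) with ∨ₛ⊆InJoinOfNegatives p
    ... | a , b , a∈ , b∈ , h∈ = a , b , a∈ , b∈ , cl-strong h∈ ah≤e e≤h⇒a

  module _ (⇒-distribˡ-∨ : ∀ x y z → (z ⇒ (x ∨ y)) ≡ ((z ⇒ x) ∨ (z ⇒ y))) where

    C-∩⊆C-∨ : ∀ {a b x} → a ≤ e → b ≤ e → x ∈ₛ C[ a ] → x ∈ₛ C[ b ] → x ∈ₛ C[ a ∨ b ]
    C-∩⊆C-∨ {a} {b} {x} a≤e b≤e x∈Ca x∈Cb with C⊆PowerTrapped a≤e x∈Ca | C⊆PowerTrapped b≤e x∈Cb
    ... | m , tm | n , tn = cl-strong d^[m+n]∈ (proj₂ d^[m+n]-traps-x) (e≤⇒-intro (proj₁ d^[m+n]-traps-x))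
      where
        d : Carrier
        d = (e ⇒ a) ∨ (e ⇒ b)
        d^[m+n]-traps-x : d ^ (m + n) Traps x
        d^[m+n]-traps-x = Traps-antitone (∨-Traps tm tn)
          (∨-^-≤ (≤-trans ([e⇒x]≤x a) a≤e) (≤-trans ([e⇒x]≤x b) b≤e) m n)
        d∈ : d ∈ₛ C[ a ∨ b ]
        d∈ = subst (_∈ₛ C[ a ∨ b ]) (⇒-distribˡ-∨ a b e) (cl-⇒ cl-e (a∈C[a] (a ∨ b)))
        d^[m+n]∈ : (d ^ (m + n)) ∈ₛ C[ a ∨ b ]
        d^[m+n]∈ = ^-∈ (Closure-isSCS _) d∈ (m + n)

    C-∨-isMeet : ∀ {a b} → a ≤ e → b ≤ e → IsMeet C[ a ] C[ b ] C[ a ∨ b ]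
    C-∨-isMeet {a} {b} a≤e b≤e =
      C-antitone x≤x∨y a∨b≤e , C-antitone y≤x∨y a∨b≤e ,
      λ M M⊆Ca M⊆Cb x∈M → C-∩⊆C-∨ a≤e b≤e (M⊆Ca x∈M) (M⊆Cb x∈M)
      where
        a∨b≤e : a ∨ b ≤ e
        a∨b≤e = ∨-least a≤e b≤e

    ∈C-∨⇔ : ∀ {a b} → a ≤ e → b ≤ e → ∀ x → x ∈ₛ C[ a ∨ b ] ⇔ (x ∈ₛ C[ a ] × x ∈ₛ C[ b ])
    ∈C-∨⇔ a≤e b≤e x = mk⇔
      (λ x∈ → C-antitone x≤x∨y (∨-least a≤e b≤e) x∈ , C-antitone y≤x∨y (∨-least a≤e b≤e) x∈)
      (λ (x∈Ca , x∈Cb) → C-∩⊆C-∨ a≤e b≤e x∈Ca x∈Cb)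

    IsMeet-compact : ∀ H K M → IsCompact ℓ H → IsCompact ℓ K → IsMeet H K M → IsCompact ℓ M
    IsMeet-compact H K M H-compact K-compact M-meet
      with compact⇒principal H H-compact | compact⇒principal K K-compact
    ... | a , a≤e , H⊆Ca , Ca⊆H | b , b≤e , K⊆Cb , Cb⊆K =
      IsCompact-resp M C[ a ∨ b ]
        (IsMeet-mono {H} {K} {C[ a ]} {C[ b ]} M C[ a ∨ b ] H⊆Ca K⊆Cb M-meet (C-∨-isMeet a≤e b≤e))
        (IsMeet-mono {C[ a ]} {C[ b ]} {H} {K} C[ a ∨ b ] M Ca⊆H Cb⊆K (C-∨-isMeet a≤e b≤e) M-meet)
        (C-compact (a ∨ b))

    isDistributive : IsDistributive
    isDistributive H K L KL M HK HL J KL-join (M⊆H , M⊆KL , _) HK-meet HL-meet (HK⊆J , HL⊆J , _) {w} w∈M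
      with ∨ₛ⊆InJoinOfNegatives K L (proj₂ (proj₂ KL-join) (K ∨ₛ L) (base ∘ inj₁) (base ∘ inj₂) (M⊆KL w∈M))
    ... | a , b , (a∈K , a≤e) , (b∈L , b≤e) , w∈Ca∧b = C-least (proj₂ J) c∨[a∧b]∈J w∈C[c∨[a∧b]]
      where
        c = φ w
        c∈H : c ∈ₛ H
        c∈H = φ-∈ (proj₂ H) (M⊆H w∈M)
        c∨[a∧b]∈J : (c ∨ (a ∧ b)) ∈ₛ J
        c∨[a∧b]∈J = ∨-∈-∧-closed (proj₂ J) a≤e b≤e (φ-≤e w)
          (HK⊆J (∨-∈-IsMeet {H} {K} {HK} HK-meet c∈H a∈K (φ-≤e w) a≤e))
          (HL⊆J (∨-∈-IsMeet {H} {L} {HL} HL-meet c∈H b∈L (φ-≤e w) b≤e))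
        w∈C[c∨[a∧b]] : w ∈ₛ C[ c ∨ (a ∧ b) ]
        w∈C[c∨[a∧b]] = C-∩⊆C-∨ (φ-≤e w) (≤-trans x∧y≤x a≤e) (y∈C[φy] w) w∈Ca∧b

corollary5p3 : ∀ {ℓ : Level} (A : SrlMonoid ℓ) →
    let open SrlMonoid A in
    let open SCSTheory A in
    (∀ x y z → (z ⇒ (x ∨ y)) ≡ ((z ⇒ x) ∨ (z ⇒ y))) →
    (IsAlgebraic ℓ × IsDistributive)
    × (∀ H → IsCompact ℓ H ⇔ (∃[ a ] (a ≤ e × H ⊆ₛ C[ a ] × C[ a ] ⊆ₛ H)))
    × (∀ H K → IsCompact ℓ H → IsCompact ℓ K →
         (∀ J → IsJoin H K J → IsCompact ℓ J) × (∀ M → IsMeet H K M → IsCompact ℓ M))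
    × (∀ a b → a ≤ e → b ≤ e →
         IsJoin C[ a ] C[ b ] C[ a ∧ b ]
         × (∀ x → x ∈ₛ C[ a ∨ b ] ⇔ (x ∈ₛ C[ a ] × x ∈ₛ C[ b ])))
corollary5p3 A ⇒-distribˡ-∨ =
  ((isComplete , isCompactlyGenerated) , isDistributive ⇒-distribˡ-∨) ,
  (λ H → mk⇔ (compact⇒principal H) (principal⇒compact H)) ,
  (λ H K H-compact K-compact →
    (λ J → IsJoin-compact H K J H-compact K-compact) ,
    (λ M → IsMeet-compact ⇒-distribˡ-∨ H K M H-compact K-compact)) ,
  (λ a b a≤e b≤e → C-∧-isJoin a≤e b≤e , ∈C-∨⇔ ⇒-distribˡ-∨ a≤e b≤e)
  where open SCSProperties A
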